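{- There is an absolute constant $C>0$ such that for every odd prime power $q$ and every $K\subset\mathbb{H}^1(\mathbb{F}_q)$, \[ |K|\le C\left(\frac{|\pi_1(K)|\,|\pi_2(K)|}{q}+q^{1/2}\sqrt{|\pi_1(K)|\,|\pi_2(K)|}\right). \] In particular, there is an absolute constant $c>0$ with $\max\{|\pi_1(K)|,|\pi_2(K)|\}\ge c\min\{|K|^{1/2}q^{1/2},\ |K|q^{ -1/2}\}$.
   Context: $\mathbb{H}^1(\mathbb{F}_q)$ is $\mathbb{F}_q^3$ with product $(x_1,x_2,t)\cdot(x_1',x_2',t')=(x_1+x_1',x_2+x_2',t+t'+\tfrac12(x_1x_2'-x_2x_1'))$. The projections $\pi_1,\pi_2:\mathbb{H}^1(\mathbb{F}_q)\to\mathbb{F}_q^2$ are $\pi_1(x_1,x_2,t)=(x_2,\,t+\tfrac12x_1x_2)$ and $\pi_2(x_1,x_2,t)=(x_1,\,t-\tfrac12x_1x_2)$. -}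

module Defs where

open import Level using (0ℓ)
open import Data.Nat as ℕ using (ℕ; suc)
open import Data.Fin as Fin using (Fin)
open import Data.Fin.Properties as FinP using ()
open import Data.Bool using (Bool; true; false; _∧_)
open import Data.List using (List; length; filter; map; allFin; cartesianProduct)
open import Data.Bool.ListAction using (any)
open import Data.Product using (_×_; _,_; ∃)
open import Relation.Nullary using (¬_; Dec; yes; no; does)
open import Relation.Nullary.Decidable using (⌊_⌋)
open import Relation.Unary using (Pred; Decidable)
open import Relation.Binary.PropositionalEquality using (_≡_; _≢_; refl; cong; sym; trans)
open import Algebra.Structures using (IsCommutativeRing)
open import Function.Bundles using (_↔_; Inverse)

record FiniteField : Set₁ where
  infixl 7 _*_
  infixl 6 _+_
  field
    Carrier : Set
    _+_ _*_ : Carrier → Carrier → Carrier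
    -_      : Carrier → Carrier
    0# 1#   : Carrier
    isCommutativeRing : IsCommutativeRing _≡_ _+_ _*_ -_ 0# 1#
    1≢0     : 1# ≢ 0#
    _⁻¹     : Carrier → Carrier
    ⁻¹-inverse : ∀ x → x ≢ 0# → x * (x ⁻¹) ≡ 1#
    size    : ℕ
    enum    : Fin size ↔ Carrier

  open Inverse enum public using (to; from; strictlyInverseˡ)

  _≟_ : (x y : Carrier) → Dec (x ≡ y)
  x ≟ y with from x FinP.≟ from y
  ... | yes p = yes (trans (sym (strictlyInverseˡ x))
                      (trans (cong to p) (strictlyInverseˡ y)))
  ... | no ¬p = no (λ e → ¬p (cong from e))

  elements : List Carrier
  elements = map to (allFin size)

  ½ : Carrier
  ½ = (1# + 1#) ⁻¹

-- The first Heisenberg group ℍ¹(F_q) has underlying set F_q³;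
-- a subset K ⊆ ℍ¹(F_q) is given as a decidable (Boolean) predicate.
module Heisenberg (F : FiniteField) where
  open FiniteField F

  H : Set
  H = Carrier × Carrier × Carrier

  Subset : Set
  Subset = H → Bool

  allH : List H
  allH = cartesianProduct elements (cartesianProduct elements elements)

  allPlane : List (Carrier × Carrier)
  allPlane = cartesianProduct elements elements

  π₁ : H → Carrier × Carrier
  π₁ (x₁ , x₂ , t) = (x₂ , t + ½ * x₁ * x₂)

  π₂ : H → Carrier × Carrier
  π₂ (x₁ , x₂ , t) = (x₁ , t + - (½ * x₁ * x₂))

  _≟²_ : (p r : Carrier × Carrier) → Bool
  (a , b) ≟² (c , d) = ⌊ a ≟ c ⌋ ∧ ⌊ b ≟ d ⌋

  card : Subset → ℕ
  card K = length (filter (λ h → K h Data.Bool.≟ true) allH)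

  imageCard : (H → Carrier × Carrier) → Subset → ℕ
  imageCard π K =
    length (filter (λ p → any (λ h → K h ∧ (π h ≟² p)) allH Data.Bool.≟ true) allPlane)

-- Write P, Q for the indicator functions of π₁(K), π₂(K) ⊆ F², and read (c , e) ∈ π₂(K) as the
-- line b = c a + e of the (a , b)-plane. Since π₁(x₁, x₂, t) = (x₂, s) with s = t + ½x₁x₂ and
-- π₂(x₁, x₂, t) = (x₁, s − x₁x₂), each h ∈ K is an incidence between the point π₁ h and the line
-- π₂ h, and distinct h give distinct incidences; hence |K| ≤ I = ∑ₚ P(p) d(p), where d(p) counts the
-- lines through p. Every line has q points, so ∑ d = q|π₂K|, and two distinct lines meet at most
-- once, so ∑ d² ≤ q|π₂K| + |π₂K|². Cauchy–Schwarz for ∑ₚ P(p) (q d(p) − |π₂K|) then gives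
-- (q I − |π₁K||π₂K|)² ≤ q³|π₁K||π₂K|, the first bound with C = 1; the second (with D = 3) is
-- elementary arithmetic from the first. Oddness of q is needed only for ½: if 1 + 1 = 0, then
-- x ↦ x + 1 is a fixed-point-free involution of F, which forces q to be even.

module Submission where

open import Defs
open import Level using (0ℓ)
open import Data.Nat as ℕ using (ℕ; zero; suc)
import Data.Nat.Properties as ℕP
open import Data.Fin as Fin using (Fin; zero; suc)
import Data.Fin.Properties as FinP
open import Data.Fin.Permutation using (permutation)
open import Data.Integer as ℤ using (ℤ)
import Data.Integer.Properties as ℤP
open import Data.Bool as Bool using (Bool; true; false; T; _∧_; if_then_else_)
open import Data.Bool.Properties using (T-∧)
open import Data.Bool.ListAction using (any)
open import Data.List using (List; []; _∷_; _++_; map; filter; length; tabulate; allFin; cartesianProduct)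
open import Data.List.Relation.Unary.Any.Properties using (any⁺)
open import Data.List.Membership.Propositional using (_∈_; lose)
open import Data.List.Membership.Propositional.Properties using (∈-map⁺; ∈-allFin; ∈-cartesianProduct⁺)
open import Data.Product using (Σ; ∃; _×_; _,_)
open import Data.Unit using (tt)
open import Data.Empty using (⊥-elim)
open import Function using (_∘_; Equivalence)
open import Function.Bundles using (_↔_; Inverse)
open import Algebra.Bundles using (CommutativeRing)
import Algebra.Properties.Ring as RingProperties
import Algebra.Properties.Semiring.Sum as SemiringSum
open import Relation.Binary.Definitions using (DecidableEquality; tri<; tri≈; tri>)
open import Relation.Binary.PropositionalEquality
open import Relation.Nullary using (Dec; yes; no; does)
open import Relation.Nullary.Decidable using (dec-true; dec-false; fromWitness)

module FiniteSums where
  open import Data.Integer using (+_; -[1+_]; 0ℤ; 1ℤ; -1ℤ; +≤+; _+_; _-_; _*_; -_; _≤_)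
  open import Data.Integer.Tactic.RingSolver using (solve-∀)

  record Summation (I : Set) : Set where
    field
      ∑        : (I → ℤ) → ℤ
      ∑-cong   : ∀ {f g} → f ≗ g → ∑ f ≡ ∑ g
      ∑-+      : ∀ f g → ∑ (λ i → f i + g i) ≡ ∑ f + ∑ g
      ∑-*ˡ     : ∀ c f → ∑ (λ i → c * f i) ≡ c * ∑ f
      ∑-nonneg : ∀ {f} → (∀ i → 0ℤ ≤ f i) → 0ℤ ≤ ∑ f

  square-nonneg : ∀ i → 0ℤ ≤ i * i
  square-nonneg (+ n)    = subst (0ℤ ≤_) (ℤP.pos-* n n) (+≤+ ℕ.z≤n)
  square-nonneg -[1+ n ] = subst (0ℤ ≤_) (ℤP.pos-* (suc n) (suc n)) (+≤+ ℕ.z≤n)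

  module SummationProperties {I : Set} (μ : Summation I) where
    open Summation μ public

    ∑-*ʳ : ∀ f c → ∑ (λ i → f i * c) ≡ ∑ f * c
    ∑-*ʳ f c = begin
      ∑ (λ i → f i * c) ≡⟨ ∑-cong (λ i → ℤP.*-comm (f i) c) ⟩
      ∑ (λ i → c * f i) ≡⟨ ∑-*ˡ c f ⟩
      c * ∑ f           ≡⟨ ℤP.*-comm c (∑ f) ⟩
      ∑ f * c           ∎
      where open ≡-Reasoning

    ∑-product : ∀ f g → ∑ f * ∑ g ≡ ∑ (λ i → ∑ (λ j → f i * g j))
    ∑-product f g = begin
      ∑ f * ∑ g                        ≡⟨ sym (∑-*ʳ f (∑ g)) ⟩
      ∑ (λ i → f i * ∑ g)              ≡⟨ ∑-cong (λ i → sym (∑-*ˡ (f i) g)) ⟩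
      ∑ (λ i → ∑ (λ j → f i * g j))    ∎
      where open ≡-Reasoning

    ∑-- : ∀ f g → ∑ (λ i → f i - g i) ≡ ∑ f - ∑ g
    ∑-- f g = begin
      ∑ (λ i → f i - g i)         ≡⟨ ∑-cong (λ i → cong (_+_ (f i)) (sym (ℤP.-1*i≡-i (g i)))) ⟩
      ∑ (λ i → f i + -1ℤ * g i)   ≡⟨ ∑-+ f _ ⟩
      ∑ f + ∑ (λ i → -1ℤ * g i)   ≡⟨ cong (_+_ (∑ f)) (∑-*ˡ -1ℤ g) ⟩
      ∑ f + -1ℤ * ∑ g             ≡⟨ cong (_+_ (∑ f)) (ℤP.-1*i≡-i (∑ g)) ⟩
      ∑ f - ∑ g                   ∎
      where open ≡-Reasoning

    ∑-mono-≤ : ∀ {f g} → (∀ i → f i ≤ g i) → ∑ f ≤ ∑ g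
    ∑-mono-≤ {f} {g} f≤g = ℤP.0≤i-j⇒j≤i (subst (0ℤ ≤_) (∑-- g f) (∑-nonneg (λ i → ℤP.i≤j⇒0≤j-i (f≤g i))))

    ∑-linear₃ : ∀ a b c (x y z : I → ℤ) →
      ∑ (λ i → a * x i + (b * y i + c * z i)) ≡ a * ∑ x + (b * ∑ y + c * ∑ z)
    ∑-linear₃ a b c x y z = begin
      ∑ (λ i → a * x i + (b * y i + c * z i))              ≡⟨ ∑-+ _ _ ⟩
      ∑ (λ i → a * x i) + ∑ (λ i → b * y i + c * z i)      ≡⟨ cong₂ _+_ (∑-*ˡ a x) (∑-+ _ _) ⟩
      a * ∑ x + (∑ (λ i → b * y i) + ∑ (λ i → c * z i))    ≡⟨ cong (_+_ (a * ∑ x)) (cong₂ _+_ (∑-*ˡ b y) (∑-*ˡ c z)) ⟩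
      a * ∑ x + (b * ∑ y + c * ∑ z)                        ∎
      where open ≡-Reasoning

    -- Lagrange identity: the double sum of (f i g j − f j g i)² is 2 (∑ f² ∑ g² − (∑ f g)²).
    cauchy-schwarz : ∀ (f g : I → ℤ) →
      ∑ (λ i → f i * g i) * ∑ (λ i → f i * g i) ≤ ∑ (λ i → f i * f i) * ∑ (λ i → g i * g i)
    cauchy-schwarz f g =
      ℤP.0≤i-j⇒j≤i (ℤP.*-cancelˡ-≤-pos 0ℤ (∑ ff * ∑ gg - ∑ fg * ∑ fg) (+ 2) twice-gap-nonneg)
      where
      open ≡-Reasoning
      ff gg fg : I → ℤ
      ff i = f i * f i
      gg i = g i * g i
      fg i = f i * g i

      expand : ∀ x y x′ y′ → (x * y′ - x′ * y) * (x * y′ - x′ * y)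
                           ≡ (x * x) * (y′ * y′) + ((y * y) * (x′ * x′) + ((- + 2) * (x * y)) * (x′ * y′))
      expand = solve-∀
      regroup : ∀ x y z X Y Z → x * X + (y * Y + ((- + 2) * z) * Z) ≡ X * x + (Y * y + ((- + 2) * Z) * z)
      regroup = solve-∀
      collect : ∀ a b c → c * a + (a * c + ((- + 2) * b) * b) ≡ + 2 * (a * c - b * b)
      collect = solve-∀

      lagrange : ∑ (λ i → ∑ (λ j → (f i * g j - f j * g i) * (f i * g j - f j * g i)))
               ≡ + 2 * (∑ ff * ∑ gg - ∑ fg * ∑ fg)
      lagrange = begin
        ∑ (λ i → ∑ (λ j → (f i * g j - f j * g i) * (f i * g j - f j * g i)))
          ≡⟨ ∑-cong (λ i → ∑-cong (λ j → expand (f i) (g i) (f j) (g j))) ⟩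
        ∑ (λ i → ∑ (λ j → ff i * gg j + (gg i * ff j + ((- + 2) * fg i) * fg j)))
          ≡⟨ ∑-cong (λ i → ∑-linear₃ (ff i) (gg i) ((- + 2) * fg i) gg ff fg) ⟩
        ∑ (λ i → ff i * ∑ gg + (gg i * ∑ ff + ((- + 2) * fg i) * ∑ fg))
          ≡⟨ ∑-cong (λ i → regroup (ff i) (gg i) (fg i) (∑ gg) (∑ ff) (∑ fg)) ⟩
        ∑ (λ i → ∑ gg * ff i + (∑ ff * gg i + ((- + 2) * ∑ fg) * fg i))
          ≡⟨ ∑-linear₃ (∑ gg) (∑ ff) ((- + 2) * ∑ fg) ff gg fg ⟩
        ∑ gg * ∑ ff + (∑ ff * ∑ gg + ((- + 2) * ∑ fg) * ∑ fg)
          ≡⟨ collect (∑ ff) (∑ fg) (∑ gg) ⟩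
        + 2 * (∑ ff * ∑ gg - ∑ fg * ∑ fg) ∎

      twice-gap-nonneg : 0ℤ ≤ + 2 * (∑ ff * ∑ gg - ∑ fg * ∑ fg)
      twice-gap-nonneg = subst (0ℤ ≤_) lagrange
        (∑-nonneg (λ i → ∑-nonneg (λ j → square-nonneg (f i * g j - f j * g i))))

    -- Read I as q² points, P as a set of points, and d p as the number of lines through p, for a
    -- family of B lines with q points each, any two of which share at most one point.
    incidence-bound : ∀ {q B : ℤ} {P d : I → ℤ} → (∀ i → P i * P i ≡ P i) →
      ∑ (λ _ → 1ℤ) ≡ q * q → ∑ d ≡ q * B → ∑ (λ i → d i * d i) ≤ q * B + B * B →
      (q * ∑ (λ i → P i * d i) - ∑ P * B) * (q * ∑ (λ i → P i * d i) - ∑ P * B) ≤ ∑ P * (q * q * (q * B))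
    incidence-bound {q} {B} {P} {d} P²≡P ∑1≡q² ∑d≡qB ∑d²≤ = begin
      X * X                      ≡⟨ sym (cong₂ _*_ ∑Py≡X ∑Py≡X) ⟩
      ∑ Py * ∑ Py                ≤⟨ cauchy-schwarz P y ⟩
      ∑ (λ i → P i * P i) * ∑ yy ≡⟨ cong (_* ∑ yy) (∑-cong P²≡P) ⟩
      ∑ P * ∑ yy                 ≤⟨ ℤP.*-monoˡ-≤-nonNeg (∑ P) {{ℤ.nonNegative ∑P≥0}} ∑yy≤ ⟩
      ∑ P * (q * q * (q * B))    ∎
      where
      open ℤP.≤-Reasoning
      X = q * ∑ (λ i → P i * d i) - ∑ P * B
      y Py yy : I → ℤ
      y i  = q * d i - B
      Py i = P i * y i
      yy i = y i * y i

      ∑P≥0 : 0ℤ ≤ ∑ P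
      ∑P≥0 = ∑-nonneg (λ i → subst (0ℤ ≤_) (P²≡P i) (square-nonneg (P i)))

      ∑Py≡X : ∑ Py ≡ X
      ∑Py≡X = begin-equality
        ∑ Py                                            ≡⟨ ∑-cong (λ i → split q B (P i) (d i)) ⟩
        ∑ (λ i → q * (P i * d i) + (- B) * P i)         ≡⟨ ∑-+ (λ i → q * (P i * d i)) (λ i → (- B) * P i) ⟩
        ∑ (λ i → q * (P i * d i)) + ∑ (λ i → (- B) * P i)  ≡⟨ cong₂ _+_ (∑-*ˡ q (λ i → P i * d i)) (∑-*ˡ (- B) P) ⟩
        q * ∑ (λ i → P i * d i) + (- B) * ∑ P           ≡⟨ merge q B (∑ (λ i → P i * d i)) (∑ P) ⟩
        X                                               ∎
        where
        split : ∀ q B p e → p * (q * e - B) ≡ q * (p * e) + (- B) * p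
        split = solve-∀
        merge : ∀ q B I A → q * I + (- B) * A ≡ q * I - A * B
        merge = solve-∀

      ∑yy≤ : ∑ yy ≤ q * q * (q * B)
      ∑yy≤ = begin
        ∑ yy                                          ≡⟨ ∑-cong (λ i → expand q B (d i)) ⟩
        ∑ (λ i → q² * dd i + (c * d i + B² * 1ℤ))     ≡⟨ ∑-linear₃ q² c B² dd d (λ _ → 1ℤ) ⟩
        q² * ∑ dd + (c * ∑ d + B² * ∑ (λ _ → 1ℤ))     ≡⟨ cong₂ (λ s t → q² * ∑ dd + (c * s + B² * t)) ∑d≡qB ∑1≡q² ⟩
        q² * ∑ dd + (c * (q * B) + B² * q²)           ≤⟨ ℤP.+-monoˡ-≤ _ (ℤP.*-monoˡ-≤-nonNeg q² {{q²≥0}} ∑d²≤) ⟩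
        q² * (q * B + B²) + (c * (q * B) + B² * q²)   ≡⟨ simplify q B ⟩
        q² * (q * B)                                  ∎
        where
        q² B² c : ℤ
        q² = q * q
        B² = B * B
        c  = - (+ 2 * q * B)
        dd : I → ℤ
        dd i = d i * d i
        q²≥0 : ℤ.NonNegative q²
        q²≥0 = ℤ.nonNegative (square-nonneg q)
        expand : ∀ q B e → (q * e - B) * (q * e - B) ≡ (q * q) * (e * e) + ((- (+ 2 * q * B)) * e + (B * B) * 1ℤ)
        expand = solve-∀
        simplify : ∀ q B → (q * q) * (q * B + B * B) + ((- (+ 2 * q * B)) * (q * B) + (B * B) * (q * q)) ≡ q * q * (q * B)
        simplify = solve-∀

  pushforward : ∀ {I A : Set} → (I → A) → Summation I → Summation A
  pushforward g μ = record
    { ∑        = λ f → ∑ (f ∘ g)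
    ; ∑-cong   = λ f≗h → ∑-cong (f≗h ∘ g)
    ; ∑-+      = λ f h → ∑-+ (f ∘ g) (h ∘ g)
    ; ∑-*ˡ     = λ c f → ∑-*ˡ c (f ∘ g)
    ; ∑-nonneg = λ f≥0 → ∑-nonneg (f≥0 ∘ g)
    }
    where open Summation μ

  infixr 7 _⊗_
  _⊗_ : ∀ {I J : Set} → Summation I → Summation J → Summation (I × J)
  μ ⊗ ν = record
    { ∑        = λ f → μ.∑ (λ i → ν.∑ (λ j → f (i , j)))
    ; ∑-cong   = λ f≗g → μ.∑-cong (λ i → ν.∑-cong (λ j → f≗g (i , j)))
    ; ∑-+      = λ f g → trans (μ.∑-cong (λ i → ν.∑-+ _ _)) (μ.∑-+ _ _)
    ; ∑-*ˡ     = λ c f → trans (μ.∑-cong (λ i → ν.∑-*ˡ c _)) (μ.∑-*ˡ c _)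
    ; ∑-nonneg = λ f≥0 → μ.∑-nonneg (λ i → ν.∑-nonneg (λ j → f≥0 (i , j)))
    }
    where
    module μ = Summation μ
    module ν = Summation ν

  module ℤΣ = SemiringSum ℤP.+-*-semiring

  sum-nonneg : ∀ {n} {f : Fin n → ℤ} → (∀ i → 0ℤ ≤ f i) → 0ℤ ≤ ℤΣ.sum f
  sum-nonneg {zero}  f≥0 = ℤP.≤-refl
  sum-nonneg {suc n} f≥0 = ℤP.+-mono-≤ (f≥0 zero) (sum-nonneg (f≥0 ∘ suc))

  finSummation : ∀ n → Summation (Fin n)
  finSummation n = record
    { ∑        = ℤΣ.sum
    ; ∑-cong   = ℤΣ.sum-cong-≗
    ; ∑-+      = ℤΣ.∑-distrib-+
    ; ∑-*ˡ     = λ c f → sym (ℤΣ.*-distribˡ-sum c f)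
    ; ∑-nonneg = sum-nonneg
    }

  sum-ones : ∀ n → ℤΣ.sum {n} (λ _ → 1ℤ) ≡ + n
  sum-ones zero    = refl
  sum-ones (suc n) = cong (_+_ 1ℤ) (sum-ones n)

  𝟙 : Bool → ℤ
  𝟙 true  = 1ℤ
  𝟙 false = 0ℤ

  𝟙-nonneg : ∀ b → 0ℤ ≤ 𝟙 b
  𝟙-nonneg true  = +≤+ ℕ.z≤n
  𝟙-nonneg false = +≤+ ℕ.z≤n

  𝟙-∧ : ∀ a b → 𝟙 a * 𝟙 b ≡ 𝟙 (a ∧ b)
  𝟙-∧ true  true  = refl
  𝟙-∧ true  false = refl
  𝟙-∧ false true  = refl
  𝟙-∧ false false = refl

  𝟙-mono : ∀ {a b} → (T a → T b) → 𝟙 a ≤ 𝟙 b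
  𝟙-mono {false} {b}     _   = 𝟙-nonneg b
  𝟙-mono {true}  {true}  _   = ℤP.≤-refl
  𝟙-mono {true}  {false} a⇒b = ⊥-elim (a⇒b tt)

  𝟙-idempotent : ∀ b → 𝟙 b * 𝟙 b ≡ 𝟙 b
  𝟙-idempotent true  = refl
  𝟙-idempotent false = refl

  does-cong : ∀ {P Q : Set} → (P → Q) → (Q → P) → (p? : Dec P) (q? : Dec Q) → does p? ≡ does q?
  does-cong P→Q Q→P (yes p) q? = sym (dec-true q? (P→Q p))
  does-cong P→Q Q→P (no ¬p) q? = sym (dec-false q? (¬p ∘ Q→P))

  sum-indicator-≡ : ∀ {n} (j : Fin n) → ℤΣ.sum (λ i → 𝟙 (does (j FinP.≟ i))) ≡ 1ℤ
  sum-indicator-≡ {suc n} zero = cong (_+_ 1ℤ) (ℤΣ.sum-replicate-zero n)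
  sum-indicator-≡ {suc n} (suc j) = trans (ℤP.+-identityˡ _) (sum-indicator-≡ j)

  listSum : ∀ {A : Set} → (A → ℤ) → List A → ℤ
  listSum f []       = 0ℤ
  listSum f (x ∷ xs) = f x + listSum f xs

  length-filter≡listSum : ∀ {A : Set} (p : A → Bool) xs →
    + length (filter (λ x → p x Bool.≟ true) xs) ≡ listSum (𝟙 ∘ p) xs
  length-filter≡listSum p []       = refl
  length-filter≡listSum p (x ∷ xs) with p x
  ... | true  = cong (_+_ 1ℤ) (length-filter≡listSum p xs)
  ... | false = trans (length-filter≡listSum p xs) (sym (ℤP.+-identityˡ _))

  listSum-cong : ∀ {A : Set} {f g : A → ℤ} → f ≗ g → ∀ xs → listSum f xs ≡ listSum g xs
  listSum-cong f≗g []       = refl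
  listSum-cong f≗g (x ∷ xs) = cong₂ _+_ (f≗g x) (listSum-cong f≗g xs)

  listSum-++ : ∀ {A : Set} (f : A → ℤ) xs ys → listSum f (xs ++ ys) ≡ listSum f xs + listSum f ys
  listSum-++ f []       ys = sym (ℤP.+-identityˡ _)
  listSum-++ f (x ∷ xs) ys = trans (cong (_+_ (f x)) (listSum-++ f xs ys)) (sym (ℤP.+-assoc (f x) _ _))

  listSum-map : ∀ {A B : Set} (f : B → ℤ) (g : A → B) xs → listSum f (map g xs) ≡ listSum (f ∘ g) xs
  listSum-map f g []       = refl
  listSum-map f g (x ∷ xs) = cong (_+_ (f (g x))) (listSum-map f g xs)

  listSum-cartesianProduct : ∀ {A B : Set} (f : A × B → ℤ) xs ys →
    listSum f (cartesianProduct xs ys) ≡ listSum (λ x → listSum (λ y → f (x , y)) ys) xs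
  listSum-cartesianProduct f []       ys = refl
  listSum-cartesianProduct f (x ∷ xs) ys =
    trans (listSum-++ f (map (x ,_) ys) _)
          (cong₂ _+_ (listSum-map f (x ,_) ys) (listSum-cartesianProduct f xs ys))

  listSum-tabulate : ∀ {A : Set} {n} (f : A → ℤ) (g : Fin n → A) → listSum f (tabulate g) ≡ ℤΣ.sum (f ∘ g)
  listSum-tabulate {n = zero}  f g = refl
  listSum-tabulate {n = suc n} f g = cong (_+_ (f (g zero))) (listSum-tabulate f (g ∘ suc))

  module EnumeratedSum {A : Set} {n : ℕ} (enum : Fin n ↔ A) where
    open Inverse enum using (to; from; strictlyInverseˡ; strictlyInverseʳ)

    summation : Summation A
    summation = pushforward to (finSummation n)

    open SummationProperties summation public

    ∑-comm : ∀ (f : A → A → ℤ) → ∑ (λ x → ∑ (λ y → f x y)) ≡ ∑ (λ y → ∑ (λ x → f x y))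
    ∑-comm f = ℤΣ.∑-comm (λ i j → f (to i) (to j))

    ∑-constant : ∀ c → ∑ (λ _ → c) ≡ + n * c
    ∑-constant c = begin
      ∑ (λ _ → c)         ≡⟨ ∑-cong (λ _ → sym (ℤP.*-identityˡ c)) ⟩
      ∑ (λ _ → 1ℤ * c)    ≡⟨ ∑-*ʳ (λ _ → 1ℤ) c ⟩
      ∑ (λ _ → 1ℤ) * c    ≡⟨ cong (_* c) (sum-ones n) ⟩
      + n * c             ∎
      where open ≡-Reasoning

    ∑∑-comm : ∀ (f : A → A → A → A → ℤ) →
      ∑ (λ a → ∑ (λ b → ∑ (λ c → ∑ (λ d → f a b c d)))) ≡ ∑ (λ c → ∑ (λ d → ∑ (λ a → ∑ (λ b → f a b c d))))
    ∑∑-comm f = begin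
      ∑ (λ a → ∑ (λ b → ∑ (λ c → ∑ (λ d → f a b c d)))) ≡⟨ ∑-cong (λ a → ∑-comm (λ b c → ∑ (f a b c))) ⟩
      ∑ (λ a → ∑ (λ c → ∑ (λ b → ∑ (λ d → f a b c d)))) ≡⟨ ∑-cong (λ a → ∑-cong (λ c → ∑-comm (λ b → f a b c))) ⟩
      ∑ (λ a → ∑ (λ c → ∑ (λ d → ∑ (λ b → f a b c d)))) ≡⟨ ∑-comm (λ a c → ∑ (λ d → ∑ (λ b → f a b c d))) ⟩
      ∑ (λ c → ∑ (λ a → ∑ (λ d → ∑ (λ b → f a b c d)))) ≡⟨ ∑-cong (λ c → ∑-comm (λ a d → ∑ (λ b → f a b c d))) ⟩
      ∑ (λ c → ∑ (λ d → ∑ (λ a → ∑ (λ b → f a b c d)))) ∎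
      where open ≡-Reasoning

    ∑-bijection : ∀ (σ τ : A → A) → (∀ x → σ (τ x) ≡ x) → (∀ x → τ (σ x) ≡ x) →
                  ∀ f → ∑ (f ∘ σ) ≡ ∑ f
    ∑-bijection σ τ στ τσ f = begin
      ℤΣ.sum (f ∘ σ ∘ to)          ≡⟨ ℤΣ.sum-cong-≗ (λ i → cong f (sym (strictlyInverseˡ (σ (to i))))) ⟩
      ℤΣ.sum (f ∘ to ∘ σ′)         ≡⟨ sym (ℤΣ.sum-permute (f ∘ to) (permutation σ′ τ′ σ′τ′ τ′σ′)) ⟩
      ℤΣ.sum (f ∘ to)              ∎
      where
      open ≡-Reasoning
      σ′ τ′ : Fin n → Fin n
      σ′ = from ∘ σ ∘ to
      τ′ = from ∘ τ ∘ to
      σ′τ′ : ∀ i → σ′ (τ′ i) ≡ i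
      σ′τ′ i = trans (cong (from ∘ σ) (strictlyInverseˡ (τ (to i)))) (trans (cong from (στ (to i))) (strictlyInverseʳ i))
      τ′σ′ : ∀ i → τ′ (σ′ i) ≡ i
      τ′σ′ i = trans (cong (from ∘ τ) (strictlyInverseˡ (σ (to i)))) (trans (cong from (τσ (to i))) (strictlyInverseʳ i))

    ∑-indicator-≡ : (_≟_ : DecidableEquality A) → ∀ a → ∑ (λ x → 𝟙 (does (a ≟ x))) ≡ 1ℤ
    ∑-indicator-≡ _≟_ a = trans (ℤΣ.sum-cong-≗ (λ i → cong 𝟙 (does-cong a≡⇒ ⇒a≡ (a ≟ to i) (from a FinP.≟ i))))
                                 (sum-indicator-≡ (from a))
      where
      a≡⇒ : ∀ {i} → a ≡ to i → from a ≡ i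
      a≡⇒ {i} refl = strictlyInverseʳ i
      ⇒a≡ : ∀ {i} → from a ≡ i → a ≡ to i
      ⇒a≡ refl = sym (strictlyInverseˡ a)

    listSum-enumeration : ∀ f → listSum f (map to (allFin n)) ≡ ∑ f
    listSum-enumeration f = trans (listSum-map f to (allFin n)) (listSum-tabulate (f ∘ to) (λ i → i))

open FiniteSums

module FixedPointFreeInvolutions where
  open import Data.Nat using (_+_; _*_)

  module ℕΣ = SemiringSum ℕP.+-*-semiring

  -- Pair each i with σ i and count each pair once, at its smaller element.
  fixedPointFree-involution⇒even : ∀ {n} (σ : Fin n → Fin n) →
    (∀ i → σ (σ i) ≡ i) → (∀ i → σ i ≢ i) → ∃ λ m → n ≡ 2 * m
  fixedPointFree-involution⇒even {n} σ σσ≡id σi≢i = ℕΣ.sum ascent , n≡2m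
    where
    [_<_] : Fin n → Fin n → ℕ
    [ i < j ] = if does (i FinP.<? j) then 1 else 0

    ascent descent : Fin n → ℕ
    ascent i  = [ i < σ i ]
    descent i = [ σ i < i ]

    ascent+descent≡1 : ∀ i → ascent i + descent i ≡ 1
    ascent+descent≡1 i with FinP.<-cmp i (σ i)
    ... | tri< i<σi _ σi≮i rewrite dec-true (i FinP.<? σ i) i<σi | dec-false (σ i FinP.<? i) σi≮i = refl
    ... | tri≈ _ i≡σi _    = ⊥-elim (σi≢i i (sym i≡σi))
    ... | tri> i≮σi _ σi<i rewrite dec-false (i FinP.<? σ i) i≮σi | dec-true (σ i FinP.<? i) σi<i = refl

    ∑descent≡∑ascent : ℕΣ.sum descent ≡ ℕΣ.sum ascent
    ∑descent≡∑ascent = begin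
      ℕΣ.sum descent        ≡⟨ ℕΣ.sum-cong-≗ (λ i → cong (λ j → [ σ i < j ]) (sym (σσ≡id i))) ⟩
      ℕΣ.sum (ascent ∘ σ)   ≡⟨ sym (ℕΣ.sum-permute ascent (permutation σ σ σσ≡id σσ≡id)) ⟩
      ℕΣ.sum ascent         ∎
      where open ≡-Reasoning

    m≡∑1 : ∀ m → m ≡ ℕΣ.sum {m} (λ _ → 1)
    m≡∑1 zero    = refl
    m≡∑1 (suc m) = cong suc (m≡∑1 m)

    n≡2m : n ≡ 2 * ℕΣ.sum ascent
    n≡2m = begin
      n                                    ≡⟨ m≡∑1 n ⟩
      ℕΣ.sum {n} (λ _ → 1)                 ≡⟨ ℕΣ.sum-cong-≗ (sym ∘ ascent+descent≡1) ⟩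
      ℕΣ.sum (λ i → ascent i + descent i)  ≡⟨ ℕΣ.∑-distrib-+ ascent descent ⟩
      ℕΣ.sum ascent + ℕΣ.sum descent       ≡⟨ cong (_+_ (ℕΣ.sum ascent)) ∑descent≡∑ascent ⟩
      ℕΣ.sum ascent + ℕΣ.sum ascent        ≡⟨ cong (_+_ (ℕΣ.sum ascent)) (sym (ℕP.+-identityʳ _)) ⟩
      2 * ℕΣ.sum ascent                    ∎
      where open ≡-Reasoning

open FixedPointFreeInvolutions

module NaturalArithmetic where
  open import Data.Nat using (_+_; _*_; _∸_; _^_; _≤_; _⊔_; _⊓_; NonZero; z≤n; s≤s)
  open import Data.Nat.Properties
  open import Data.Nat.Tactic.RingSolver using (solve-∀)
  open import Data.Integer using (+_)

  ∸-square-bound : ∀ {m n r : ℕ} {x : ℤ} → + m ℤ.- + n ℤ.≤ x → x ℤ.* x ℤ.≤ + r → (m ∸ n) * (m ∸ n) ≤ r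
  ∸-square-bound {m} {n} {r} {x} m-n≤x x²≤r with m ≤? n
  ... | yes m≤n rewrite m≤n⇒m∸n≡0 m≤n = z≤n
  ... | no m≰n = ℤP.drop‿+≤+ (begin
    + ((m ∸ n) * (m ∸ n))    ≡⟨ ℤP.pos-* (m ∸ n) (m ∸ n) ⟩
    + (m ∸ n) ℤ.* + (m ∸ n)  ≤⟨ ℤP.*-monoˡ-≤-nonNeg (+ (m ∸ n)) m∸n≤x ⟩
    + (m ∸ n) ℤ.* x          ≤⟨ ℤP.*-monoʳ-≤-nonNeg x {{ℤ.nonNegative (ℤP.≤-trans (ℤ.+≤+ z≤n) m∸n≤x)}} m∸n≤x ⟩
    x ℤ.* x                  ≤⟨ x²≤r ⟩
    + r                      ∎)
    where
    open ℤP.≤-Reasoning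
    m∸n≤x : + (m ∸ n) ℤ.≤ x
    m∸n≤x = ℤP.≤-trans (ℤP.≤-reflexive (sym (trans (ℤP.m-n≡m⊖n m n) (ℤP.⊖-≥ (<⇒≤ (≰⇒> m≰n)))))) m-n≤x

  -- With S = max(A,B)²: either qk ≤ 2S, or else qk ≤ 2 (qk ∸ S) ≤ 2 (qk ∸ AB), so that (qk)² ≤ 4q³S.
  projection-lower-bound : ∀ q k A B → .{{NonZero q}} → (q * k ∸ A * B) ^ 2 ≤ q ^ 3 * A * B →
                     (k * q ^ 2) ⊓ (k ^ 2) ≤ 4 * q * (A ⊔ B) ^ 2
  projection-lower-bound q k A B incidence with q * k ≤? 2 * S
    where S = (A ⊔ B) * (A ⊔ B)
  ... | yes qk≤2S = begin
    (k * q ^ 2) ⊓ (k ^ 2)     ≤⟨ m⊓n≤m _ _ ⟩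
    k * q ^ 2                 ≡⟨ lhs-form k q ⟩
    q * (q * k)               ≤⟨ *-monoʳ-≤ q qk≤2S ⟩
    q * (2 * S)               ≤⟨ *-monoʳ-≤ q (*-monoˡ-≤ S {2} {4} (s≤s (s≤s z≤n))) ⟩
    q * (4 * S)               ≡⟨ rhs-form q (A ⊔ B) ⟩
    4 * q * (A ⊔ B) ^ 2       ∎
    where
    open ≤-Reasoning
    S = (A ⊔ B) * (A ⊔ B)
    lhs-form : ∀ k q → k * (q * (q * 1)) ≡ q * (q * k)
    lhs-form = solve-∀
    rhs-form : ∀ q M → q * (4 * (M * M)) ≡ 4 * q * (M * (M * 1))
    rhs-form = solve-∀
  ... | no qk≰2S = begin
    (k * q ^ 2) ⊓ (k ^ 2)     ≤⟨ m⊓n≤n _ _ ⟩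
    k ^ 2                     ≤⟨ *-cancelˡ-≤ q (*-cancelˡ-≤ q q²k²≤q²[4qS]) ⟩
    4 * q * S                 ≡⟨ square-form q (A ⊔ B) ⟩
    4 * q * (A ⊔ B) ^ 2       ∎
    where
    open ≤-Reasoning
    S = (A ⊔ B) * (A ⊔ B)
    w = q * k ∸ S
    AB≤S : A * B ≤ S
    AB≤S = *-mono-≤ (m≤m⊔n A B) (m≤n⊔m A B)
    S+S≤qk : S + S ≤ q * k
    S+S≤qk = subst (_≤ q * k) (cong (_+_ S) (+-identityʳ S)) (<⇒≤ (≰⇒> qk≰2S))
    qk≤w+w : q * k ≤ w + w
    qk≤w+w = begin
      q * k      ≡⟨ sym (m∸n+n≡m (m+n≤o⇒n≤o S S+S≤qk)) ⟩
      w + S      ≤⟨ +-monoʳ-≤ w (m+n≤o⇒m≤o∸n S S+S≤qk) ⟩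
      w + w      ∎
    w≤incidence : w ≤ q * k ∸ A * B
    w≤incidence = ∸-monoʳ-≤ (q * k) AB≤S
    q²k²≤q²[4qS] : q * (q * k ^ 2) ≤ q * (q * (4 * q * S))
    q²k²≤q²[4qS] = begin
      q * (q * k ^ 2)                ≡⟨ square-product q k ⟩
      (q * k) * (q * k)              ≤⟨ *-mono-≤ qk≤w+w qk≤w+w ⟩
      (w + w) * (w + w)              ≡⟨ double-square w ⟩
      4 * (w * w)                    ≤⟨ *-monoʳ-≤ 4 (*-mono-≤ w≤incidence w≤incidence) ⟩
      4 * (v * v)                    ≡⟨ cong (4 *_) (square≡^2 v) ⟩
      4 * v ^ 2                      ≤⟨ *-monoʳ-≤ 4 incidence ⟩
      4 * (q ^ 3 * A * B)            ≡⟨ cong (4 *_) (*-assoc (q ^ 3) A B) ⟩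
      4 * (q ^ 3 * (A * B))          ≤⟨ *-monoʳ-≤ 4 (*-monoʳ-≤ (q ^ 3) AB≤S) ⟩
      4 * (q ^ 3 * S)                ≡⟨ regroup q S ⟩
      q * (q * (4 * q * S))          ∎
      where
      v = q * k ∸ A * B
      square-product : ∀ q k → q * (q * (k * (k * 1))) ≡ (q * k) * (q * k)
      square-product = solve-∀
      double-square : ∀ w → (w + w) * (w + w) ≡ 4 * (w * w)
      double-square = solve-∀
      square≡^2 : ∀ v → v * v ≡ v * (v * 1)
      square≡^2 = solve-∀
      regroup : ∀ q S → 4 * (q * (q * (q * 1)) * S) ≡ q * (q * (4 * q * S))
      regroup = solve-∀
    square-form : ∀ q M → 4 * q * (M * M) ≡ 4 * q * (M * (M * 1))
    square-form = solve-∀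

open NaturalArithmetic

module FieldFacts (F : FiniteField) where
  open FiniteField F
  open Inverse enum using (strictlyInverseʳ)
  commutativeRing : CommutativeRing 0ℓ 0ℓ
  commutativeRing = record { isCommutativeRing = isCommutativeRing }
  open CommutativeRing commutativeRing
    using (_-_; +-assoc; +-comm; +-identityʳ; -‿inverseʳ; *-assoc; *-comm; *-identityˡ; zeroˡ; distribʳ; ring)
  open RingProperties ring using (+-identityʳ-unique; -‿+-comm; [y-z]x≈yx-zx; x∙y⁻¹≈ε⇒x≈y)
  open RingProperties ring public using (//-rightDividesˡ; //-rightDividesʳ)
  open EnumeratedSum enum public
  open ≡-Reasoning

  1+1≢0 : Σ ℕ (λ k → size ≡ suc (2 ℕ.* k)) → 1# + 1# ≢ 0#
  1+1≢0 (k , q≡odd) 1+1≡0 =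
    let m , q≡2m = fixedPointFree-involution⇒even shift shift-involutive shift-fixedPointFree
    in  ℕP.even≢odd m k (trans (sym q≡2m) q≡odd)
    where
    shift : Fin size → Fin size
    shift = from ∘ (_+ 1#) ∘ to
    shift-involutive : ∀ i → shift (shift i) ≡ i
    shift-involutive i = begin
      from (to (from (to i + 1#)) + 1#) ≡⟨ cong (λ x → from (x + 1#)) (strictlyInverseˡ (to i + 1#)) ⟩
      from ((to i + 1#) + 1#)           ≡⟨ cong from (+-assoc (to i) 1# 1#) ⟩
      from (to i + (1# + 1#))           ≡⟨ cong (λ x → from (to i + x)) 1+1≡0 ⟩
      from (to i + 0#)                  ≡⟨ cong from (+-identityʳ (to i)) ⟩
      from (to i)                       ≡⟨ strictlyInverseʳ i ⟩
      i                                 ∎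
    shift-fixedPointFree : ∀ i → shift i ≢ i
    shift-fixedPointFree i shift-i≡i = 1≢0 (+-identityʳ-unique (to i) 1#
      (trans (sym (strictlyInverseˡ (to i + 1#))) (cong to shift-i≡i)))

  ∑-translate : ∀ v f → ∑ (λ x → f (x + v)) ≡ ∑ f
  ∑-translate v = ∑-bijection (_+ v) (_- v) (//-rightDividesˡ v) (//-rightDividesʳ v)

  ∑-scale : ∀ {u} → u ≢ 0# → ∀ f → ∑ (λ x → f (u * x)) ≡ ∑ f
  ∑-scale {u} u≢0 = ∑-bijection (u *_) (u ⁻¹ *_) u[u⁻¹x]≡x u⁻¹[ux]≡x
    where
    u[u⁻¹x]≡x : ∀ x → u * (u ⁻¹ * x) ≡ x
    u[u⁻¹x]≡x x = begin
      u * (u ⁻¹ * x) ≡⟨ sym (*-assoc u (u ⁻¹) x) ⟩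
      u * u ⁻¹ * x   ≡⟨ cong (_* x) (⁻¹-inverse u u≢0) ⟩
      1# * x         ≡⟨ *-identityˡ x ⟩
      x              ∎
    u⁻¹[ux]≡x : ∀ x → u ⁻¹ * (u * x) ≡ x
    u⁻¹[ux]≡x x = begin
      u ⁻¹ * (u * x) ≡⟨ cong (u ⁻¹ *_) (*-comm u x) ⟩
      u ⁻¹ * (x * u) ≡⟨ sym (*-assoc (u ⁻¹) x u) ⟩
      u ⁻¹ * x * u   ≡⟨ *-comm (u ⁻¹ * x) u ⟩
      u * (u ⁻¹ * x) ≡⟨ u[u⁻¹x]≡x x ⟩
      x              ∎

  ∑-affine : ∀ {u} → u ≢ 0# → ∀ b f → ∑ (λ a → f (b + u * a)) ≡ ∑ f
  ∑-affine {u} u≢0 b f = begin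
    ∑ (λ a → f (b + u * a)) ≡⟨ ∑-scale u≢0 (λ x → f (b + x)) ⟩
    ∑ (λ x → f (b + x))     ≡⟨ ∑-cong (λ x → cong f (+-comm b x)) ⟩
    ∑ (λ x → f (x + b))     ≡⟨ ∑-translate b f ⟩
    ∑ f                     ∎

  ½+½≡1 : 1# + 1# ≢ 0# → ½ + ½ ≡ 1#
  ½+½≡1 1+1≢0 = begin
    ½ + ½             ≡⟨ sym (cong₂ _+_ (*-identityˡ ½) (*-identityˡ ½)) ⟩
    1# * ½ + 1# * ½   ≡⟨ sym (distribʳ ½ 1# 1#) ⟩
    (1# + 1#) * ½     ≡⟨ ⁻¹-inverse (1# + 1#) 1+1≢0 ⟩
    1#                ∎

  s-½xy-½xy≡s-xy : 1# + 1# ≢ 0# → ∀ s x y → (s - ½ * x * y) - ½ * x * y ≡ s - x * y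
  s-½xy-½xy≡s-xy 1+1≢0 s x y = begin
    (s - h) - h      ≡⟨ +-assoc s (- h) (- h) ⟩
    s + (- h + - h)  ≡⟨ cong (s +_) (-‿+-comm h h) ⟩
    s - (h + h)      ≡⟨ cong (λ z → s - z) h+h≡xy ⟩
    s - x * y        ∎
    where
    h = ½ * x * y
    h+h≡xy : h + h ≡ x * y
    h+h≡xy = begin
      ½ * x * y + ½ * x * y     ≡⟨ sym (distribʳ y (½ * x) (½ * x)) ⟩
      (½ * x + ½ * x) * y       ≡⟨ cong (_* y) (sym (distribʳ x ½ ½)) ⟩
      (½ + ½) * x * y           ≡⟨ cong (λ z → z * x * y) (½+½≡1 1+1≢0) ⟩
      1# * x * y                ≡⟨ cong (_* y) (*-identityˡ x) ⟩
      x * y                     ∎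

  b+ca-c′a≡b+[c-c′]a : ∀ a b c c′ → (b + c * a) - c′ * a ≡ b + (c - c′) * a
  b+ca-c′a≡b+[c-c′]a a b c c′ = begin
    (b + c * a) - c′ * a   ≡⟨ +-assoc b (c * a) (- (c′ * a)) ⟩
    b + (c * a - c′ * a)   ≡⟨ cong (b +_) (sym ([y-z]x≈yx-zx a c c′)) ⟩
    b + (c - c′) * a       ∎

  b+[c-c]a≡b : ∀ a b c → b + (c - c) * a ≡ b
  b+[c-c]a≡b a b c = begin
    b + (c - c) * a  ≡⟨ cong (λ z → b + z * a) (-‿inverseʳ c) ⟩
    b + 0# * a       ≡⟨ cong (b +_) (zeroˡ a) ⟩
    b + 0#           ≡⟨ +-identityʳ b ⟩
    b                ∎

  x≢y⇒x-y≢0 : ∀ {c c′} → c ≢ c′ → c - c′ ≢ 0#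
  x≢y⇒x-y≢0 {c} {c′} c≢c′ c-c′≡0 = c≢c′ (x∙y⁻¹≈ε⇒x≈y c c′ c-c′≡0)

module Incidences (F : FiniteField) (K : Heisenberg.Subset F) where
  open import Data.Nat using (_∸_; _^_)
  open import Data.Integer using (+_; 1ℤ; _+_; _-_; _*_; _≤_)
  open import Data.Integer.Tactic.RingSolver using (solve-∀)
  import Data.Nat.Tactic.RingSolver as ℕSolver
  open FiniteField F renaming (_+_ to _⊕_; _*_ to _⊙_; -_ to ⊖_)
  open Heisenberg F
  open FieldFacts F

  plane : Summation (Carrier × Carrier)
  plane = summation ⊗ summation

  module Plane = SummationProperties plane

  space : Summation H
  space = summation ⊗ plane

  module Space = SummationProperties space

  listSum-allPlane : ∀ f → listSum f allPlane ≡ Plane.∑ f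
  listSum-allPlane f = begin
    listSum f allPlane
      ≡⟨ listSum-cartesianProduct f elements elements ⟩
    listSum (λ a → listSum (λ b → f (a , b)) elements) elements
      ≡⟨ listSum-cong (λ a → listSum-enumeration (λ b → f (a , b))) elements ⟩
    listSum (λ a → ∑ (λ b → f (a , b))) elements
      ≡⟨ listSum-enumeration _ ⟩
    Plane.∑ f ∎
    where open ≡-Reasoning

  listSum-allH : ∀ f → listSum f allH ≡ Space.∑ f
  listSum-allH f = begin
    listSum f allH
      ≡⟨ listSum-cartesianProduct f elements allPlane ⟩
    listSum (λ x → listSum (λ p → f (x , p)) allPlane) elements
      ≡⟨ listSum-cong (λ x → listSum-allPlane (λ p → f (x , p))) elements ⟩
    listSum (λ x → Plane.∑ (λ p → f (x , p))) elements
      ≡⟨ listSum-enumeration _ ⟩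
    Space.∑ f ∎
    where open ≡-Reasoning

  image : (H → Carrier × Carrier) → Carrier × Carrier → Bool
  image π p = any (λ h → K h ∧ (π h ≟² p)) allH

  card≡∑ : + card K ≡ Space.∑ (𝟙 ∘ K)
  card≡∑ = trans (length-filter≡listSum K allH) (listSum-allH (𝟙 ∘ K))

  imageCard≡∑ : ∀ π → + imageCard π K ≡ Plane.∑ (𝟙 ∘ image π)
  imageCard≡∑ π = trans (length-filter≡listSum (image π) allPlane) (listSum-allPlane (𝟙 ∘ image π))

  ∈-elements : ∀ x → x ∈ elements
  ∈-elements x = subst (_∈ elements) (strictlyInverseˡ x) (∈-map⁺ to (∈-allFin (from x)))

  ∈-allH : ∀ h → h ∈ allH
  ∈-allH (x₁ , x₂ , t) = ∈-cartesianProduct⁺ (∈-elements x₁) (∈-cartesianProduct⁺ (∈-elements x₂) (∈-elements t))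

  ≟²-refl : ∀ p → T (p ≟² p)
  ≟²-refl (a , b) = Equivalence.from T-∧ (fromWitness {a? = a ≟ a} refl , fromWitness {a? = b ≟ b} refl)

  ∈-image : ∀ π {h} → T (K h) → T (image π (π h))
  ∈-image π {h} h∈K = any⁺ _ (lose (∈-allH h) (Equivalence.from T-∧ (h∈K , ≟²-refl (π h))))

  P Q : Carrier × Carrier → ℤ
  P = 𝟙 ∘ image π₁
  Q = 𝟙 ∘ image π₂

  K⊆preimages : ∀ h → 𝟙 (K h) ≤ P (π₁ h) * Q (π₂ h)
  K⊆preimages h = subst (𝟙 (K h) ≤_) (sym (𝟙-∧ (image π₁ (π₁ h)) (image π₂ (π₂ h))))
    (𝟙-mono (λ h∈K → Equivalence.from T-∧ (∈-image π₁ h∈K , ∈-image π₂ h∈K)))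

  -- onLine c p: the line of slope c through p belongs to π₂(K).
  onLine : Carrier → Carrier × Carrier → ℤ
  onLine c (a , b) = Q (c , b ⊕ ⊖ (c ⊙ a))

  linesThrough : Carrier × Carrier → ℤ
  linesThrough p = ∑ (λ c → onLine c p)

  card≤incidences : 1# ⊕ 1# ≢ 0# → + card K ≤ Plane.∑ (λ p → P p * linesThrough p)
  card≤incidences 1+1≢0 = begin
    + card K
      ≡⟨ card≡∑ ⟩
    Space.∑ (𝟙 ∘ K)
      ≤⟨ Space.∑-mono-≤ K⊆preimages ⟩
    Space.∑ (λ h → P (π₁ h) * Q (π₂ h))
      ≡⟨ ∑-cong (λ x → ∑-cong (λ y → shear x y)) ⟩
    ∑ (λ x → ∑ (λ y → ∑ (λ s → incidence x y s)))
      ≡⟨ ∑-comm (λ x y → ∑ (incidence x y)) ⟩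
    ∑ (λ y → ∑ (λ x → ∑ (λ s → incidence x y s)))
      ≡⟨ ∑-cong (λ y → ∑-comm (λ x s → incidence x y s)) ⟩
    ∑ (λ y → ∑ (λ s → ∑ (λ x → incidence x y s)))
      ≡⟨ ∑-cong (λ y → ∑-cong (λ s → ∑-*ˡ (P (y , s)) (λ x → onLine x (y , s)))) ⟩
    Plane.∑ (λ p → P p * linesThrough p) ∎
    where
    open ℤP.≤-Reasoning
    incidence : Carrier → Carrier → Carrier → ℤ
    incidence x y s = P (y , s) * onLine x (y , s)
    shear : ∀ x y → ∑ (λ t → P (π₁ (x , y , t)) * Q (π₂ (x , y , t))) ≡ ∑ (incidence x y)
    shear x y = trans (sym (∑-translate (⊖ h) (λ t → P (π₁ (x , y , t)) * Q (π₂ (x , y , t)))))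
      (∑-cong (λ s → cong₂ (λ u v → P (y , u) * Q (x , v)) (//-rightDividesˡ h s) (s-½xy-½xy≡s-xy 1+1≢0 s x y)))
      where h = ½ ⊙ x ⊙ y

  linesWithSlope : Carrier → ℤ
  linesWithSlope c = ∑ (λ e → Q (c , e))

  ∑-linesThrough : Plane.∑ linesThrough ≡ + size * Plane.∑ Q
  ∑-linesThrough = begin
    ∑ (λ a → ∑ (λ b → ∑ (λ c → Q (c , b ⊕ ⊖ (c ⊙ a)))))
      ≡⟨ ∑-cong (λ a → ∑-comm (λ b c → Q (c , b ⊕ ⊖ (c ⊙ a)))) ⟩
    ∑ (λ a → ∑ (λ c → ∑ (λ b → Q (c , b ⊕ ⊖ (c ⊙ a)))))
      ≡⟨ ∑-cong (λ a → ∑-cong (λ c → ∑-translate (⊖ (c ⊙ a)) (λ e → Q (c , e)))) ⟩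
    ∑ (λ a → Plane.∑ Q)
      ≡⟨ ∑-constant (Plane.∑ Q) ⟩
    + size * Plane.∑ Q ∎
    where open ≡-Reasoning

  commonPoints : Carrier → Carrier → ℤ
  commonPoints c c′ = Plane.∑ (λ p → onLine c p * onLine c′ p)

  commonPoints-sheared : ∀ c c′ →
    commonPoints c c′ ≡ ∑ (λ a → ∑ (λ b → Q (c , b) * Q (c′ , b ⊕ (c ⊕ ⊖ c′) ⊙ a)))
  commonPoints-sheared c c′ = ∑-cong λ a →
    trans (sym (∑-translate (c ⊙ a) (λ b → onLine c (a , b) * onLine c′ (a , b))))
          (∑-cong (λ b → cong₂ (λ u v → Q (c , u) * Q (c′ , v)) (//-rightDividesʳ (c ⊙ a) b) (b+ca-c′a≡b+[c-c′]a a b c c′)))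

  commonPoints-same : ∀ c → commonPoints c c ≡ + size * linesWithSlope c
  commonPoints-same c = begin
    commonPoints c c
      ≡⟨ commonPoints-sheared c c ⟩
    ∑ (λ a → ∑ (λ b → Q (c , b) * Q (c , b ⊕ (c ⊕ ⊖ c) ⊙ a)))
      ≡⟨ ∑-cong (λ a → ∑-cong (λ b → trans (cong (λ e → Q (c , b) * Q (c , e)) (b+[c-c]a≡b a b c))
                                            (𝟙-idempotent (image π₂ (c , b))))) ⟩
    ∑ (λ a → linesWithSlope c)
      ≡⟨ ∑-constant (linesWithSlope c) ⟩
    + size * linesWithSlope c ∎
    where open ≡-Reasoning

  commonPoints-distinct : ∀ {c c′} → c ≢ c′ → commonPoints c c′ ≡ linesWithSlope c * linesWithSlope c′
  commonPoints-distinct {c} {c′} c≢c′ = begin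
    commonPoints c c′
      ≡⟨ commonPoints-sheared c c′ ⟩
    ∑ (λ a → ∑ (λ b → Q (c , b) * Q (c′ , b ⊕ u ⊙ a)))
      ≡⟨ ∑-comm (λ a b → Q (c , b) * Q (c′ , b ⊕ u ⊙ a)) ⟩
    ∑ (λ b → ∑ (λ a → Q (c , b) * Q (c′ , b ⊕ u ⊙ a)))
      ≡⟨ ∑-cong (λ b → ∑-*ˡ (Q (c , b)) (λ a → Q (c′ , b ⊕ u ⊙ a))) ⟩
    ∑ (λ b → Q (c , b) * ∑ (λ a → Q (c′ , b ⊕ u ⊙ a)))
      ≡⟨ ∑-cong (λ b → cong (Q (c , b) *_) (∑-affine (x≢y⇒x-y≢0 c≢c′) b (λ e → Q (c′ , e)))) ⟩
    ∑ (λ b → Q (c , b) * linesWithSlope c′)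
      ≡⟨ ∑-*ʳ (λ b → Q (c , b)) (linesWithSlope c′) ⟩
    linesWithSlope c * linesWithSlope c′ ∎
    where
    open ≡-Reasoning
    u = c ⊕ ⊖ c′

  commonPoints-≤ : ∀ c c′ →
    commonPoints c c′ ≤ linesWithSlope c * linesWithSlope c′ + 𝟙 (does (c ≟ c′)) * (+ size * linesWithSlope c)
  commonPoints-≤ c c′ with c ≟ c′
  ... | yes refl = begin
    commonPoints c c
      ≡⟨ commonPoints-same c ⟩
    + size * linesWithSlope c
      ≡⟨ sym (ℤP.*-identityˡ _) ⟩
    1ℤ * (+ size * linesWithSlope c)
      ≤⟨ ℤP.i≤j+i _ _ {{ℤ.nonNegative (square-nonneg (linesWithSlope c))}} ⟩
    linesWithSlope c * linesWithSlope c + 1ℤ * (+ size * linesWithSlope c) ∎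
    where open ℤP.≤-Reasoning
  ... | no c≢c′ = ℤP.≤-reflexive (trans (commonPoints-distinct c≢c′) (sym (ℤP.+-identityʳ _)))

  ∑-linesThrough² : Plane.∑ (λ p → linesThrough p * linesThrough p) ≤ + size * Plane.∑ Q + Plane.∑ Q * Plane.∑ Q
  ∑-linesThrough² = begin
    Plane.∑ (λ p → linesThrough p * linesThrough p)
      ≡⟨ Plane.∑-cong (λ p → ∑-product (λ c → onLine c p) (λ c′ → onLine c′ p)) ⟩
    Plane.∑ (λ p → ∑ (λ c → ∑ (λ c′ → onLine c p * onLine c′ p)))
      ≡⟨ ∑∑-comm (λ a b c c′ → onLine c (a , b) * onLine c′ (a , b)) ⟩
    ∑ (λ c → ∑ (λ c′ → commonPoints c c′))
      ≤⟨ ∑-mono-≤ (λ c → ∑-mono-≤ (commonPoints-≤ c)) ⟩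
    ∑ (λ c → ∑ (λ c′ → L c * L c′ + 𝟙 (does (c ≟ c′)) * (+ size * L c)))
      ≡⟨ ∑-cong (λ c → ∑-+ (λ c′ → L c * L c′) (λ c′ → 𝟙 (does (c ≟ c′)) * (+ size * L c))) ⟩
    ∑ (λ c → ∑ (λ c′ → L c * L c′) + ∑ (λ c′ → 𝟙 (does (c ≟ c′)) * (+ size * L c)))
      ≡⟨ ∑-cong (λ c → cong₂ _+_ (∑-*ˡ (L c) L)
                   (trans (∑-*ʳ (λ c′ → 𝟙 (does (c ≟ c′))) (+ size * L c))
                          (cong (_* (+ size * L c)) (∑-indicator-≡ _≟_ c)))) ⟩
    ∑ (λ c → L c * ∑ L + 1ℤ * (+ size * L c))
      ≡⟨ ∑-cong (λ c → collect (L c) (∑ L) (+ size)) ⟩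
    ∑ (λ c → (∑ L + + size) * L c)
      ≡⟨ ∑-*ˡ (∑ L + + size) L ⟩
    (∑ L + + size) * ∑ L
      ≡⟨ distribute (∑ L) (+ size) ⟩
    + size * ∑ L + ∑ L * ∑ L ∎
    where
    open ℤP.≤-Reasoning
    L = linesWithSlope
    collect : ∀ x s q → x * s + 1ℤ * (q * x) ≡ (s + q) * x
    collect = solve-∀
    distribute : ∀ s q → (s + q) * s ≡ q * s + s * s
    distribute = solve-∀

  plane-mass : Plane.∑ (λ _ → 1ℤ) ≡ + size * + size
  plane-mass = trans (∑-cong (λ _ → trans (∑-constant 1ℤ) (ℤP.*-identityʳ (+ size)))) (∑-constant (+ size))

  card-bound : 1# ⊕ 1# ≢ 0# →
    (size ℕ.* card K ∸ imageCard π₁ K ℕ.* imageCard π₂ K) ^ 2 ℕ.≤ size ^ 3 ℕ.* imageCard π₁ K ℕ.* imageCard π₂ K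
  card-bound 1+1≢0 = subst₂ ℕ._≤_ (cong (w ℕ.*_) (sym (ℕP.*-identityʳ w))) (reorder q A B)
    (∸-square-bound {q ℕ.* k} {A ℕ.* B} lower upper)
    where
    q = size
    k = card K
    A = imageCard π₁ K
    B = imageCard π₂ K
    w = q ℕ.* k ∸ A ℕ.* B
    I = Plane.∑ (λ p → P p * linesThrough p)
    X = + q * I - + A * + B

    lower : + (q ℕ.* k) - + (A ℕ.* B) ≤ X
    lower = begin
      + (q ℕ.* k) - + (A ℕ.* B)  ≡⟨ cong₂ _-_ (ℤP.pos-* q k) (ℤP.pos-* A B) ⟩
      + q * + k - + A * + B      ≤⟨ ℤP.+-monoˡ-≤ (ℤ.- (+ A * + B)) (ℤP.*-monoˡ-≤-nonNeg (+ q) (card≤incidences 1+1≢0)) ⟩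
      X                          ∎
      where open ℤP.≤-Reasoning

    upper : X * X ≤ + (A ℕ.* (q ℕ.* q ℕ.* (q ℕ.* B)))
    upper = begin
      X * X                              ≤⟨ subst₂ bound-for (sym (imageCard≡∑ π₁)) (sym (imageCard≡∑ π₂)) incidences ⟩
      + A * (+ q * + q * (+ q * + B))    ≡⟨ pos-* ⟩
      + (A ℕ.* (q ℕ.* q ℕ.* (q ℕ.* B)))  ∎
      where
      open ℤP.≤-Reasoning
      bound-for : ℤ → ℤ → Set
      bound-for a b = (+ q * I - a * b) * (+ q * I - a * b) ≤ a * (+ q * + q * (+ q * b))
      incidences : bound-for (Plane.∑ P) (Plane.∑ Q)
      incidences = Plane.incidence-bound {+ q} {Plane.∑ Q} {P} {linesThrough}
                     (𝟙-idempotent ∘ image π₁) plane-mass ∑-linesThrough ∑-linesThrough²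
      pos-* : + A * (+ q * + q * (+ q * + B)) ≡ + (A ℕ.* (q ℕ.* q ℕ.* (q ℕ.* B)))
      pos-* = sym (trans (ℤP.pos-* A _) (cong (+ A *_)
                (trans (ℤP.pos-* (q ℕ.* q) _) (cong₂ _*_ (ℤP.pos-* q q) (ℤP.pos-* q B)))))

    reorder : ∀ q A B → A ℕ.* (q ℕ.* q ℕ.* (q ℕ.* B)) ≡ q ℕ.* (q ℕ.* (q ℕ.* 1)) ℕ.* A ℕ.* B
    reorder = ℕSolver.solve-∀

open import Data.Nat using (_*_; _∸_; _^_; _≤_; _⊔_; _⊓_; NonZero)

theorem1p6 : Σ ℕ λ C → Σ ℕ λ D →
  (F : FiniteField) → Σ ℕ (λ k → FiniteField.size F ≡ suc (2 * k)) →
  (K : Heisenberg.Subset F) →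
  let open Heisenberg F
      q = FiniteField.size F
      A = imageCard π₁ K
      B = imageCard π₂ K
      k = card K
  in ((q * k ∸ C * A * B) ^ 2 ≤ C ^ 2 * q ^ 3 * A * B)
     × ((k * q ^ 2) ⊓ (k ^ 2) ≤ suc D * q * (A ⊔ B) ^ 2)
theorem1p6 = 1 , 3 , λ F q-odd@(_ , q≡odd) K →
  let open Heisenberg F
      open FiniteField F using (size)
      A = imageCard π₁ K
      B = imageCard π₂ K
      incidence = Incidences.card-bound F K (FieldFacts.1+1≢0 F q-odd)
  in subst₂ _≤_ (cong (λ C*A → (size * card K ∸ C*A * B) ^ 2) (sym (ℕP.*-identityˡ A)))
                (cong (λ C²q³ → C²q³ * A * B) (sym (ℕP.*-identityˡ (size ^ 3))))
                incidence
   , projection-lower-bound size (card K) A B {{subst NonZero (sym q≡odd) _}} incidence
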